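{- Let $U\subseteq\mathbb Z$ and let $f\colon U\to\mathbb Z$ be a function that is not LIP on $U$. Let $X\subseteq U$ be a circuit for $f$. Then (1) $f_X(x)=cx^{|X|-1}+(\text{lower degree terms})$ with $c\notin\mathbb Z$; (2) if $d$ is the denominator of $c$ in lowest terms, then all elements of $X$ are congruent to each other modulo $d$.
   Context: A function $f\colon U\to\mathbb Z$ is LIP on $U$ if for every finite $Y\subseteq U$ there is $p\in\mathbb Z[x]$ with $p(y)=f(y)$ for all $y\in Y$. For finite $Y\subseteq U$, $f_Y(x)$ denotes the unique polynomial in $\mathbb Q[x]$ of degree less than $|Y|$ agreeing with $f$ on $Y$. If $f$ is not LIP on $U$, a finite subset $X\subseteq U$ is called a circuit for $f$ if $f_X\notin\mathbb Z[x]$ but $f_{X\setminus\{a\}}\in\mathbb Z[x]$ for every $a\in X$. -}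

module Defs where

open import Data.Nat using (ℕ; zero; suc; _≤_; _∸_)
open import Data.Integer as ℤ using (ℤ; +_)
open import Data.Rational as ℚ using (ℚ; _/_)
open import Data.List using (List; []; _∷_; length; map; removeAt)
open import Data.List.Relation.Unary.All using (All)
open import Data.List.Relation.Unary.Unique.Propositional using (Unique)
open import Data.Product using (Σ; ∃; _×_; proj₁)
open import Relation.Binary.PropositionalEquality using (_≡_)
open import Relation.Nullary using (¬_)

ι : ℤ → ℚ
ι z = z / 1

-- polynomials are coefficient lists, lowest degree first
-- evaluation of a rational polynomial (Horner)
evalℚ : List ℚ → ℚ → ℚ
evalℚ []       x = ℚ.0ℚ
evalℚ (c ∷ cs) x = c ℚ.+ x ℚ.* evalℚ cs x

evalℤ : List ℤ → ℤ → ℤ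
evalℤ []       x = + 0
evalℤ (c ∷ cs) x = c ℤ.+ x ℤ.* evalℤ cs x

coeff : List ℚ → ℕ → ℚ
coeff []       k       = ℚ.0ℚ
coeff (c ∷ cs) zero    = c
coeff (c ∷ cs) (suc k) = coeff cs k

-- denominator of a rational in lowest terms (ℚ is always normalised)
denom : ℚ → ℕ
denom c = ℚ.denominatorℕ c

IsInt : ℚ → Set
IsInt c = denom c ≡ 1

module _ {U : ℤ → Set} (f : Σ ℤ U → ℤ) where

  LIP : Set
  LIP = (Y : List (Σ ℤ U)) → ∃ λ (p : List ℤ) → All (λ y → evalℤ p (proj₁ y) ≡ f y) Y

  -- q is the interpolation polynomial f_Y : degree < |Y| and agreeing with f on Y
  -- (for Y with distinct elements this polynomial is unique)
  IsInterp : List (Σ ℤ U) → List ℚ → Set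
  IsInterp Y q = (length q ≤ length Y) × All (λ y → evalℚ q (ι (proj₁ y)) ≡ ι (f y)) Y

  InterpInZ : List (Σ ℤ U) → Set
  InterpInZ Y = ∃ λ (q : List ℚ) → IsInterp Y q × All IsInt q

  Circuit : List (Σ ℤ U) → Set
  Circuit X = Unique (map proj₁ X)
            × ¬ InterpInZ X
            × ((i : Data.Fin.Fin (length X)) → InterpInZ (removeAt X i))
    where import Data.Fin

-- Write X = a ∷ X′. Adding to the integral interpolant of f on X′ the multiple
-- c ∏_{y ∈ X′} (x − y) that corrects the value at a yields f_X, with leading
-- coefficient c; were c an integer, f_X would be integral, contradicting the circuit.
-- For a ≠ b in X, f_X − f_{X∖a} vanishes on X∖a, so it is c ∏_{X∖a} (x − y), while
-- f_{X∖a} − f_{X∖b} vanishes on X∖{a,b}, so it is e ∏_{X∖{a,b}} (x − y) with e ∈ ℤ a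
-- difference of coefficients of integral polynomials. Evaluating at a, where f_X and
-- f_{X∖b} agree, and cancelling ∏_{X∖{a,b}} (a − y) ≠ 0 gives c (a − b) = −e, so the
-- denominator of c divides a − b.

module Submission where

open import Defs
open import Data.Nat as ℕ using (zero; suc; _≤_; _∸_; s≤s; z≤n)
import Data.Nat.Properties as ℕP
import Data.Nat.Divisibility as ℕD
import Data.Nat.Coprimality as Coprime
open import Data.Nat.GCD using (gcd-zeroʳ)
open import Data.Integer as ℤ using (ℤ; +_)
import Data.Integer.Properties as ℤP
import Data.Integer.Divisibility as ℤD
open import Data.Integer.Tactic.RingSolver using (solve-∀)
open import Data.Rational as ℚ using (ℚ; mkℚ; 0ℚ; 1ℚ)
import Data.Rational.Properties as ℚP
import Data.Rational.Unnormalised as ℚᵘ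
import Data.Rational.Unnormalised.Properties as ℚᵘP
open import Data.Rational.Solver using (module +-*-Solver)
open import Algebra.Properties.Group ℚP.+-0-group using (x∙y⁻¹≈ε⇒x≈y; inverseˡ-unique)
open import Data.List using (List; []; _∷_; length; map; removeAt)
open import Data.List.Properties using (length-map; length-removeAt′)
open import Data.List.Relation.Unary.All as All using (All; []; _∷_)
open import Data.List.Relation.Unary.All.Properties using (─⁺)
open import Data.List.Relation.Unary.AllPairs as AllPairs using (AllPairs; []; _∷_)
import Data.List.Relation.Unary.AllPairs.Properties as AllPairsP
open import Data.List.Relation.Unary.Any using (here; there; index; _─_)
open import Data.List.Membership.Propositional using (_∈_)
open import Data.List.Relation.Unary.Unique.Propositional using (Unique)
open import Data.Fin using (zero)
open import Data.Product using (Σ; ∃; ∃-syntax; _×_; _,_; proj₁; proj₂)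
open import Data.Empty using (⊥-elim)
open import Function using (_∘_)
open import Relation.Nullary using (¬_; yes; no)
open import Relation.Binary.Core using (Rel)
open import Relation.Binary.PropositionalEquality

module _ {A : Set} where

  ∈-─⁻ : ∀ {x y : A} {xs} (x∈xs : x ∈ xs) → y ∈ (xs ─ x∈xs) → y ∈ xs
  ∈-─⁻ (here refl)  y∈xs         = there y∈xs
  ∈-─⁻ (there x∈xs) (here refl)  = here refl
  ∈-─⁻ (there x∈xs) (there y∈xs) = there (∈-─⁻ x∈xs y∈xs)

  ∈-─⁺ : ∀ {x y : A} {xs} (x∈xs : x ∈ xs) → y ∈ xs → y ≢ x → y ∈ (xs ─ x∈xs)
  ∈-─⁺ (here refl)  (here refl)  y≢x = ⊥-elim (y≢x refl)
  ∈-─⁺ (here refl)  (there y∈xs) _   = y∈xs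
  ∈-─⁺ (there x∈xs) (here refl)  _   = here refl
  ∈-─⁺ (there x∈xs) (there y∈xs) y≢x = there (∈-─⁺ x∈xs y∈xs y≢x)

  length-─ : ∀ {x : A} {xs} (x∈xs : x ∈ xs) → length xs ≡ suc (length (xs ─ x∈xs))
  length-─ {xs = xs} x∈xs = length-removeAt′ xs (index x∈xs)

  length-─-irrelevant : ∀ {x y : A} {xs} (x∈xs : x ∈ xs) (y∈xs : y ∈ xs)
    → length (xs ─ x∈xs) ≡ length (xs ─ y∈xs)
  length-─-irrelevant x∈xs y∈xs = ℕP.suc-injective (trans (sym (length-─ x∈xs)) (length-─ y∈xs))

  ─-AllPairs : ∀ {ℓ} {R : Rel A ℓ} {x : A} {xs} (x∈xs : x ∈ xs) → AllPairs R xs → AllPairs R (xs ─ x∈xs)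
  ─-AllPairs (here refl)  (_ ∷ Rxs)     = Rxs
  ─-AllPairs (there x∈xs) (Rx ∷ Rxs)    = ─⁺ x∈xs Rx ∷ ─-AllPairs x∈xs Rxs

-- ℚ's operators are opened only in this block: lemma7 below needs ℤ's _-_.
module _ where
  open import Data.Rational using (_+_; _*_; _-_; -_; 1/_)
  open +-*-Solver

  Integral : ℚ → Set
  Integral c = ∃[ z ] c ≡ ι z

  ι-toℚᵘ : ∀ z → ℚ.toℚᵘ (ι z) ℚᵘ.≃ ℚᵘ.mkℚᵘ z 0
  ι-toℚᵘ z = ℚP.toℚᵘ-fromℚᵘ (ℚᵘ.mkℚᵘ z 0)

  ι-homo-+ : ∀ m n → ι (m ℤ.+ n) ≡ ι m + ι n
  ι-homo-+ m n = ℚP.toℚᵘ-injective (ℚᵘP.≃-trans (ι-toℚᵘ (m ℤ.+ n))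
    (ℚᵘP.≃-trans (ℚᵘ.*≡* (unnormalised-+ m n))
      (ℚᵘP.≃-sym (ℚᵘP.≃-trans (ℚP.toℚᵘ-homo-+ (ι m) (ι n)) (ℚᵘP.+-cong (ι-toℚᵘ m) (ι-toℚᵘ n))))))
    where
    unnormalised-+ : ∀ m n → (m ℤ.+ n) ℤ.* + 1 ≡ (m ℤ.* + 1 ℤ.+ n ℤ.* + 1) ℤ.* + 1
    unnormalised-+ = solve-∀

  ι-homo-* : ∀ m n → ι (m ℤ.* n) ≡ ι m * ι n
  ι-homo-* m n = ℚP.toℚᵘ-injective (ℚᵘP.≃-trans (ι-toℚᵘ (m ℤ.* n))
    (ℚᵘP.≃-sym (ℚᵘP.≃-trans (ℚP.toℚᵘ-homo-* (ι m) (ι n)) (ℚᵘP.*-cong (ι-toℚᵘ m) (ι-toℚᵘ n)))))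

  ι-homo‿- : ∀ m → ι (ℤ.- m) ≡ - ι m
  ι-homo‿- m = ℚP.toℚᵘ-injective (ℚᵘP.≃-trans (ι-toℚᵘ (ℤ.- m))
    (ℚᵘP.≃-sym (ℚᵘP.≃-trans (ℚP.toℚᵘ-homo‿- (ι m)) (ℚᵘP.-‿cong (ι-toℚᵘ m)))))

  ι-homo-[-] : ∀ m n → ι (m ℤ.- n) ≡ ι m - ι n
  ι-homo-[-] m n = trans (ι-homo-+ m (ℤ.- n)) (cong (λ r → ι m + r) (ι-homo‿- n))

  ι-injective : ∀ {m n} → ι m ≡ ι n → m ≡ n
  ι-injective {m} {n} eq
    with ℚᵘP.≃-trans (ℚᵘP.≃-sym (ι-toℚᵘ m)) (ℚᵘP.≃-trans (ℚP.toℚᵘ-cong eq) (ι-toℚᵘ n))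
  ... | ℚᵘ.*≡* eq′ = trans (sym (ℤP.*-identityʳ m)) (trans eq′ (ℤP.*-identityʳ n))

  Integral⇒IsInt : ∀ {c} → Integral c → IsInt c
  Integral⇒IsInt (z , refl) = ℕP.m*n≡1⇒m≡1 _ _ (ℤP.+-injective
    (trans (cong (λ g → ℚ.↧ (ι z) ℤ.* + g) (sym (gcd-zeroʳ ℤ.∣ z ∣))) (ℚP.↧-/ z 1)))

  IsInt⇒Integral : ∀ {c} → IsInt c → Integral c
  IsInt⇒Integral {c@(mkℚ n zero _)} refl = n , sym (ℚP.↥p/↧p≡p c)

  -- From c = n / d in lowest terms and n m = e d, coprimality gives d ∣ m.
  Integral[c*m]⇒denom[c]∣m : ∀ c m → Integral (c * ι m) → + denom c ℤD.∣ m
  Integral[c*m]⇒denom[c]∣m c@(mkℚ n d-1 coprime) m (e , eq)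
    with ℚᵘP.≃-trans (ℚᵘP.≃-sym (ℚᵘP.*-cong (ℚᵘP.≃-refl {ℚ.toℚᵘ c}) (ι-toℚᵘ m)))
           (ℚᵘP.≃-trans (ℚᵘP.≃-sym (ℚP.toℚᵘ-homo-* c (ι m))) (ℚᵘP.≃-trans (ℚP.toℚᵘ-cong eq) (ι-toℚᵘ e)))
  ... | ℚᵘ.*≡* cross = Coprime.coprime-divisor (Coprime.sym (Coprime.recompute coprime))
                        (ℕD.divides ℤ.∣ e ∣ ∣n∣*∣m∣≡∣e∣*d)
    where
    open ≡-Reasoning
    ∣n∣*∣m∣≡∣e∣*d : ℤ.∣ n ∣ ℕ.* ℤ.∣ m ∣ ≡ ℤ.∣ e ∣ ℕ.* suc d-1
    ∣n∣*∣m∣≡∣e∣*d = begin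
      ℤ.∣ n ∣ ℕ.* ℤ.∣ m ∣               ≡⟨ sym (ℤP.abs-* n m) ⟩
      ℤ.∣ n ℤ.* m ∣                     ≡⟨ cong ℤ.∣_∣ (sym (ℤP.*-identityʳ (n ℤ.* m))) ⟩
      ℤ.∣ n ℤ.* m ℤ.* + 1 ∣             ≡⟨ cong ℤ.∣_∣ cross ⟩
      ℤ.∣ e ℤ.* + suc (d-1 ℕ.* 1) ∣     ≡⟨ ℤP.abs-* e _ ⟩
      ℤ.∣ e ∣ ℕ.* suc (d-1 ℕ.* 1)       ≡⟨ cong (λ k → ℤ.∣ e ∣ ℕ.* suc k) (ℕP.*-identityʳ d-1) ⟩
      ℤ.∣ e ∣ ℕ.* suc d-1               ∎

  xy≡0⇒y≡0 : ∀ {x y} → x ≢ 0ℚ → x * y ≡ 0ℚ → y ≡ 0ℚ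
  xy≡0⇒y≡0 {x} {y} x≢0 xy≡0 = begin
    y                  ≡⟨ sym (ℚP.*-identityˡ y) ⟩
    1ℚ * y             ≡⟨ cong (_* y) (sym (ℚP.*-inverseˡ x)) ⟩
    (1/ x) * x * y     ≡⟨ ℚP.*-assoc (1/ x) x y ⟩
    (1/ x) * (x * y)   ≡⟨ cong ((1/ x) *_) xy≡0 ⟩
    (1/ x) * 0ℚ        ≡⟨ ℚP.*-zeroʳ (1/ x) ⟩
    0ℚ                 ∎
    where
    open ≡-Reasoning
    instance _ = ℚ.≢-nonZero x≢0

  x≢0∧y≢0⇒xy≢0 : ∀ {x y} → x ≢ 0ℚ → y ≢ 0ℚ → x * y ≢ 0ℚ
  x≢0∧y≢0⇒xy≢0 x≢0 y≢0 = y≢0 ∘ xy≡0⇒y≡0 x≢0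

  x≢y⇒x-y≢0 : ∀ {x y} → x ≢ y → x - y ≢ 0ℚ
  x≢y⇒x-y≢0 {x} {y} x≢y = x≢y ∘ x∙y⁻¹≈ε⇒x≈y x y

  cancel-nonzero-factor : ∀ {u v w r s n} → n ≢ 0ℚ → u ≡ w → u - v ≡ r * n → v - w ≡ s * n → r ≡ - s
  cancel-nonzero-factor {u} {v} {w} {r} {s} {n} n≢0 u≡w u-v≡rn v-w≡sn =
    inverseˡ-unique r s (xy≡0⇒y≡0 n≢0 (begin
      n * (r + s)        ≡⟨ solve 3 (λ n r s → n :* (r :+ s) := r :* n :+ s :* n) refl n r s ⟩
      r * n + s * n      ≡⟨ cong₂ _+_ (sym u-v≡rn) (sym v-w≡sn) ⟩
      (u - v) + (v - w)  ≡⟨ solve 3 (λ u v w → (u :- v) :+ (v :- w) := u :- w) refl u v w ⟩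
      u - w              ≡⟨ cong (_- w) u≡w ⟩
      w - w              ≡⟨ ℚP.+-inverseʳ w ⟩
      0ℚ                 ∎))
    where open ≡-Reasoning

  -- Polynomials as coefficient lists

  infixl 6 _+ₚ_ _-ₚ_
  infixr 7 _·ₚ_

  _+ₚ_ : List ℚ → List ℚ → List ℚ
  []      +ₚ q       = q
  (a ∷ p) +ₚ []      = a ∷ p
  (a ∷ p) +ₚ (b ∷ q) = (a + b) ∷ (p +ₚ q)

  _·ₚ_ : ℚ → List ℚ → List ℚ
  c ·ₚ p = map (c *_) p

  _-ₚ_ : List ℚ → List ℚ → List ℚ
  p -ₚ q = p +ₚ (- 1ℚ) ·ₚ q

  eval-+ₚ : ∀ p q x → evalℚ (p +ₚ q) x ≡ evalℚ p x + evalℚ q x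
  eval-+ₚ []      q       x = sym (ℚP.+-identityˡ _)
  eval-+ₚ (a ∷ p) []      x = sym (ℚP.+-identityʳ _)
  eval-+ₚ (a ∷ p) (b ∷ q) x rewrite eval-+ₚ p q x =
    solve 5 (λ a b x P Q → a :+ b :+ x :* (P :+ Q) := (a :+ x :* P) :+ (b :+ x :* Q))
      refl a b x (evalℚ p x) (evalℚ q x)

  eval-·ₚ : ∀ c p x → evalℚ (c ·ₚ p) x ≡ c * evalℚ p x
  eval-·ₚ c []      x = sym (ℚP.*-zeroʳ c)
  eval-·ₚ c (a ∷ p) x rewrite eval-·ₚ c p x =
    solve 4 (λ c a x P → c :* a :+ x :* (c :* P) := c :* (a :+ x :* P)) refl c a x (evalℚ p x)

  eval-[-ₚ] : ∀ p q x → evalℚ (p -ₚ q) x ≡ evalℚ p x - evalℚ q x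
  eval-[-ₚ] p q x rewrite eval-+ₚ p ((- 1ℚ) ·ₚ q) x | eval-·ₚ (- 1ℚ) q x =
    solve 2 (λ P Q → P :+ (:- con 1ℚ) :* Q := P :- Q) refl (evalℚ p x) (evalℚ q x)

  coeff-+ₚ : ∀ p q k → coeff (p +ₚ q) k ≡ coeff p k + coeff q k
  coeff-+ₚ []      q       k       = sym (ℚP.+-identityˡ _)
  coeff-+ₚ (a ∷ p) []      k       = sym (ℚP.+-identityʳ _)
  coeff-+ₚ (a ∷ p) (b ∷ q) zero    = refl
  coeff-+ₚ (a ∷ p) (b ∷ q) (suc k) = coeff-+ₚ p q k

  coeff-·ₚ : ∀ c p k → coeff (c ·ₚ p) k ≡ c * coeff p k
  coeff-·ₚ c []      k       = sym (ℚP.*-zeroʳ c)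
  coeff-·ₚ c (a ∷ p) zero    = refl
  coeff-·ₚ c (a ∷ p) (suc k) = coeff-·ₚ c p k

  coeff-[-ₚ] : ∀ p q k → coeff (p -ₚ q) k ≡ coeff p k - coeff q k
  coeff-[-ₚ] p q k rewrite coeff-+ₚ p ((- 1ℚ) ·ₚ q) k | coeff-·ₚ (- 1ℚ) q k =
    solve 2 (λ P Q → P :+ (:- con 1ℚ) :* Q := P :- Q) refl (coeff p k) (coeff q k)

  length-+ₚ : ∀ p q → length (p +ₚ q) ≡ length p ℕ.⊔ length q
  length-+ₚ []      q       = refl
  length-+ₚ (a ∷ p) []      = refl
  length-+ₚ (a ∷ p) (b ∷ q) = cong suc (length-+ₚ p q)

  length-+ₚ-≤ : ∀ p q {n} → length p ≤ n → length q ≤ n → length (p +ₚ q) ≤ n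
  length-+ₚ-≤ p q p≤n q≤n rewrite length-+ₚ p q = ℕP.⊔-lub p≤n q≤n

  length-·ₚ : ∀ c p → length (c ·ₚ p) ≡ length p
  length-·ₚ c = length-map (c *_)

  length-[-ₚ]-≤ : ∀ p q {n} → length p ≤ n → length q ≤ n → length (p -ₚ q) ≤ n
  length-[-ₚ]-≤ p q p≤n q≤n =
    length-+ₚ-≤ p ((- 1ℚ) ·ₚ q) p≤n (subst (_≤ _) (sym (length-·ₚ (- 1ℚ) q)) q≤n)

  length≤⇒coeff≡0 : ∀ p {k} → length p ≤ k → coeff p k ≡ 0ℚ
  length≤⇒coeff≡0 []      _         = refl
  length≤⇒coeff≡0 (a ∷ p) (s≤s p≤k) = length≤⇒coeff≡0 p p≤k

  +ₚ-integral : ∀ {p q} → All Integral p → All Integral q → All Integral (p +ₚ q)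
  +ₚ-integral []             iq             = iq
  +ₚ-integral (ia ∷ ip)      []             = ia ∷ ip
  +ₚ-integral ((m , refl) ∷ ip) ((n , refl) ∷ iq) = (m ℤ.+ n , sym (ι-homo-+ m n)) ∷ +ₚ-integral ip iq

  ·ₚ-integral : ∀ {c p} → Integral c → All Integral p → All Integral (c ·ₚ p)
  ·ₚ-integral ic              []               = []
  ·ₚ-integral ic@(m , refl)   ((n , refl) ∷ ip) = (m ℤ.* n , sym (ι-homo-* m n)) ∷ ·ₚ-integral ic ip

  -ₚ-integral : ∀ {p q} → All Integral p → All Integral q → All Integral (p -ₚ q)
  -ₚ-integral ip iq = +ₚ-integral ip (·ₚ-integral (ℤ.- + 1 , refl) iq)

  coeff-integral : ∀ {p} → All Integral p → ∀ k → Integral (coeff p k)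
  coeff-integral []        k       = + 0 , refl
  coeff-integral (ia ∷ ip) zero    = ia
  coeff-integral (ia ∷ ip) (suc k) = coeff-integral ip k

  -- Synthetic division by x - y.
  deflate : ℚ → List ℚ → List ℚ
  deflate y []           = []
  deflate y (c ∷ [])     = []
  deflate y (c ∷ d ∷ ds) = evalℚ (d ∷ ds) y ∷ deflate y (d ∷ ds)

  eval-deflate : ∀ y p x → evalℚ p x ≡ evalℚ p y + (x - y) * evalℚ (deflate y p) x
  eval-deflate y []           x = solve 2 (λ x y → con 0ℚ := con 0ℚ :+ (x :- y) :* con 0ℚ) refl x y
  eval-deflate y (c ∷ [])     x =
    solve 3 (λ c x y → c :+ x :* con 0ℚ := (c :+ y :* con 0ℚ) :+ (x :- y) :* con 0ℚ) refl c x y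
  eval-deflate y (c ∷ d ∷ ds) x rewrite eval-deflate y (d ∷ ds) x =
    solve 5 (λ c x y A Q → c :+ x :* (A :+ (x :- y) :* Q) := (c :+ y :* A) :+ (x :- y) :* (A :+ x :* Q))
      refl c x y (evalℚ (d ∷ ds) y) (evalℚ (deflate y (d ∷ ds)) x)

  length-deflate : ∀ y p {k} → length p ≤ suc k → length (deflate y p) ≤ k
  length-deflate y []           _                 = z≤n
  length-deflate y (c ∷ [])     _                 = z≤n
  length-deflate y (c ∷ d ∷ ds) {suc k} (s≤s h) = s≤s (length-deflate y (d ∷ ds) h)

  coeff-deflate : ∀ y p k → length p ≤ suc (suc k) → coeff (deflate y p) k ≡ coeff p (suc k)
  coeff-deflate y []               k       _       = refl
  coeff-deflate y (c ∷ [])         k       _       = refl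
  coeff-deflate y (c ∷ d ∷ [])     zero    _       = solve 2 (λ d y → d :+ y :* con 0ℚ := d) refl d y
  coeff-deflate y (c ∷ d ∷ e ∷ ds) zero    (s≤s (s≤s ()))
  coeff-deflate y (c ∷ d ∷ ds)     (suc k) (s≤s h) = coeff-deflate y (d ∷ ds) k h

  deflate-root : ∀ y p {z} → evalℚ p y ≡ 0ℚ → evalℚ p z ≡ 0ℚ → z ≢ y → evalℚ (deflate y p) z ≡ 0ℚ
  deflate-root y p {z} py≡0 pz≡0 z≢y = xy≡0⇒y≡0 (x≢y⇒x-y≢0 z≢y) (begin
    (z - y) * evalℚ (deflate y p) z           ≡⟨ sym (ℚP.+-identityˡ _) ⟩
    0ℚ + (z - y) * evalℚ (deflate y p) z      ≡⟨ cong (_+ (z - y) * evalℚ (deflate y p) z) (sym py≡0) ⟩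
    evalℚ p y + (z - y) * evalℚ (deflate y p) z ≡⟨ sym (eval-deflate y p z) ⟩
    evalℚ p z                                  ≡⟨ pz≡0 ⟩
    0ℚ                                         ∎)
    where open ≡-Reasoning

  module Nodes {A : Set} (pt : A → ℚ) where

    Distinct : List A → Set
    Distinct = AllPairs (λ u v → pt u ≢ pt v)

    nodal : List A → ℚ → ℚ
    nodal []       x = 1ℚ
    nodal (y ∷ ys) x = (x - pt y) * nodal ys x

    nodalPoly : List A → List ℚ
    nodalPoly []       = 1ℚ ∷ []
    nodalPoly (y ∷ ys) = (0ℚ ∷ nodalPoly ys) -ₚ pt y ·ₚ nodalPoly ys

    eval-nodalPoly : ∀ ys x → evalℚ (nodalPoly ys) x ≡ nodal ys x
    eval-nodalPoly []       x = solve 1 (λ x → con 1ℚ :+ x :* con 0ℚ := con 1ℚ) refl x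
    eval-nodalPoly (y ∷ ys) x
      rewrite eval-[-ₚ] (0ℚ ∷ nodalPoly ys) (pt y ·ₚ nodalPoly ys) x
            | eval-·ₚ (pt y) (nodalPoly ys) x | eval-nodalPoly ys x =
      solve 3 (λ x y P → con 0ℚ :+ x :* P :- y :* P := (x :- y) :* P) refl x (pt y) (nodal ys x)

    length-nodalPoly : ∀ ys → length (nodalPoly ys) ≡ suc (length ys)
    length-nodalPoly []       = refl
    length-nodalPoly (y ∷ ys)
      rewrite length-+ₚ (0ℚ ∷ nodalPoly ys) ((- 1ℚ) ·ₚ pt y ·ₚ nodalPoly ys)
            | length-·ₚ (- 1ℚ) (pt y ·ₚ nodalPoly ys) | length-·ₚ (pt y) (nodalPoly ys)
            | length-nodalPoly ys = ℕP.m≥n⇒m⊔n≡m (ℕP.n≤1+n _)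

    nodalPoly-monic : ∀ ys → coeff (nodalPoly ys) (length ys) ≡ 1ℚ
    nodalPoly-monic []       = refl
    nodalPoly-monic (y ∷ ys)
      rewrite coeff-[-ₚ] (0ℚ ∷ nodalPoly ys) (pt y ·ₚ nodalPoly ys) (suc (length ys))
            | coeff-·ₚ (pt y) (nodalPoly ys) (suc (length ys)) | nodalPoly-monic ys
            | length≤⇒coeff≡0 (nodalPoly ys) (ℕP.≤-reflexive (length-nodalPoly ys)) =
      solve 1 (λ y → con 1ℚ :- y :* con 0ℚ := con 1ℚ) refl (pt y)

    nodalPoly-integral : (∀ a → Integral (pt a)) → ∀ ys → All Integral (nodalPoly ys)
    nodalPoly-integral pt-integral []       = (+ 1 , refl) ∷ []
    nodalPoly-integral pt-integral (y ∷ ys) =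
      -ₚ-integral ((+ 0 , refl) ∷ nodalPoly-integral pt-integral ys)
                  (·ₚ-integral (pt-integral y) (nodalPoly-integral pt-integral ys))

    nodal-root : ∀ {y ys} → y ∈ ys → nodal ys (pt y) ≡ 0ℚ
    nodal-root {y} {_ ∷ ys} (here refl) =
      trans (cong (_* nodal ys (pt y)) (ℚP.+-inverseʳ (pt y))) (ℚP.*-zeroˡ (nodal ys (pt y)))
    nodal-root {y} {u ∷ ys} (there y∈ys) =
      trans (cong ((pt y - pt u) *_) (nodal-root y∈ys)) (ℚP.*-zeroʳ (pt y - pt u))

    nodal-nonzero : ∀ {z} ys → All (λ y → z ≢ pt y) ys → nodal ys z ≢ 0ℚ
    nodal-nonzero []       []            ()
    nodal-nonzero (y ∷ ys) (z≢y ∷ z≢ys) = x≢0∧y≢0⇒xy≢0 (x≢y⇒x-y≢0 z≢y) (nodal-nonzero ys z≢ys)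

    nodal-─ : ∀ {a ys} (a∈ys : a ∈ ys) x → nodal ys x ≡ (x - pt a) * nodal (ys ─ a∈ys) x
    nodal-─ (here refl) x = refl
    nodal-─ {a} (there {x = y} a∈ys) x rewrite nodal-─ a∈ys x =
      solve 4 (λ x y a R → (x :- y) :* ((x :- a) :* R) := (x :- a) :* ((x :- y) :* R))
        refl x (pt y) (pt a) (nodal (_ ─ a∈ys) x)

    distinct-─ : ∀ {x xs} → Distinct xs → (x∈xs : x ∈ xs) → All (λ y → pt x ≢ pt y) (xs ─ x∈xs)
    distinct-─ (x≢xs ∷ _)        (here refl)  = x≢xs
    distinct-─ (y≢xs ∷ distinct) (there x∈xs) =
      (λ x≡y → All.lookup y≢xs x∈xs (sym x≡y)) ∷ distinct-─ distinct x∈xs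

    vanishing⇒nodal-multiple : ∀ ys p → Distinct ys → length p ≤ suc (length ys)
      → All (λ y → evalℚ p (pt y) ≡ 0ℚ) ys
      → ∀ x → evalℚ p x ≡ coeff p (length ys) * nodal ys x
    vanishing⇒nodal-multiple [] []          _ _              _ x = sym (ℚP.*-zeroˡ 1ℚ)
    vanishing⇒nodal-multiple [] (c ∷ [])    _ _              _ x =
      solve 2 (λ c x → c :+ x :* con 0ℚ := c :* con 1ℚ) refl c x
    vanishing⇒nodal-multiple [] (c ∷ d ∷ p) _ (s≤s ())       _ x
    vanishing⇒nodal-multiple (y ∷ ys) p (y≢ys ∷ distinct) len (py≡0 ∷ pys≡0) x = begin
      evalℚ p x                                         ≡⟨ eval-deflate (pt y) p x ⟩
      evalℚ p (pt y) + (x - pt y) * evalℚ s x           ≡⟨ cong₂ (λ u v → u + (x - pt y) * v) py≡0 s-factors ⟩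
      0ℚ + (x - pt y) * (coeff s n * nodal ys x)
        ≡⟨ cong (λ c → 0ℚ + (x - pt y) * (c * nodal ys x)) (coeff-deflate (pt y) p n len) ⟩
      0ℚ + (x - pt y) * (coeff p (suc n) * nodal ys x)
        ≡⟨ solve 4 (λ x y C N → con 0ℚ :+ (x :- y) :* (C :* N) := C :* ((x :- y) :* N))
             refl x (pt y) (coeff p (suc n)) (nodal ys x) ⟩
      coeff p (suc n) * ((x - pt y) * nodal ys x)       ∎
      where
      open ≡-Reasoning
      n = length ys
      s = deflate (pt y) p
      s-factors : evalℚ s x ≡ coeff s n * nodal ys x
      s-factors = vanishing⇒nodal-multiple ys s distinct (length-deflate (pt y) p len)
        (All.zipWith (λ (y≢u , pu≡0) → deflate-root (pt y) p py≡0 pu≡0 (y≢u ∘ sym))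
                     (y≢ys , pys≡0)) x

    agree⇒difference-nodal : ∀ ys p q → Distinct ys
      → length p ≤ suc (length ys) → length q ≤ suc (length ys)
      → All (λ y → evalℚ p (pt y) ≡ evalℚ q (pt y)) ys
      → ∀ x → evalℚ p x - evalℚ q x ≡ (coeff p (length ys) - coeff q (length ys)) * nodal ys x
    agree⇒difference-nodal ys p q distinct p≤ q≤ agree x = begin
      evalℚ p x - evalℚ q x                    ≡⟨ eval-[-ₚ] p q x ⟨
      evalℚ (p -ₚ q) x
        ≡⟨ vanishing⇒nodal-multiple ys (p -ₚ q) distinct (length-[-ₚ]-≤ p q p≤ q≤) (All.map vanishes agree) x ⟩
      coeff (p -ₚ q) (length ys) * nodal ys x  ≡⟨ cong (_* nodal ys x) (coeff-[-ₚ] p q (length ys)) ⟩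
      (coeff p (length ys) - coeff q (length ys)) * nodal ys x ∎
      where
      open ≡-Reasoning
      vanishes : ∀ {y} → evalℚ p (pt y) ≡ evalℚ q (pt y) → evalℚ (p -ₚ q) (pt y) ≡ 0ℚ
      vanishes {y} py≡qy = begin
        evalℚ (p -ₚ q) (pt y)             ≡⟨ eval-[-ₚ] p q (pt y) ⟩
        evalℚ p (pt y) - evalℚ q (pt y)   ≡⟨ cong (_- evalℚ q (pt y)) py≡qy ⟩
        evalℚ q (pt y) - evalℚ q (pt y)   ≡⟨ ℚP.+-inverseʳ (evalℚ q (pt y)) ⟩
        0ℚ                                ∎

    newton-step : ∀ (g : A → ℚ) a ys q → All (λ y → pt a ≢ pt y) ys
      → All (λ y → evalℚ q (pt y) ≡ g y) ys
      → ∃[ c ] All (λ y → evalℚ (q +ₚ c ·ₚ nodalPoly ys) (pt y) ≡ g y) (a ∷ ys)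
    newton-step g a ys q a≢ys q-agrees = c , agrees-at-a ∷ All.tabulate agrees-on-ys
      where
      open ≡-Reasoning
      N = nodal ys (pt a)
      instance _ = ℚ.≢-nonZero (nodal-nonzero ys a≢ys)
      c = (g a - evalℚ q (pt a)) * 1/ N
      eval-extension : ∀ x → evalℚ (q +ₚ c ·ₚ nodalPoly ys) x ≡ evalℚ q x + c * nodal ys x
      eval-extension x rewrite eval-+ₚ q (c ·ₚ nodalPoly ys) x | eval-·ₚ c (nodalPoly ys) x
                             | eval-nodalPoly ys x = refl
      agrees-at-a : evalℚ (q +ₚ c ·ₚ nodalPoly ys) (pt a) ≡ g a
      agrees-at-a = begin
        evalℚ (q +ₚ c ·ₚ nodalPoly ys) (pt a)          ≡⟨ eval-extension (pt a) ⟩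
        evalℚ q (pt a) + (g a - evalℚ q (pt a)) * 1/ N * N
          ≡⟨ solve 4 (λ Q G I N → Q :+ (G :- Q) :* I :* N := Q :+ (G :- Q) :* (I :* N))
               refl (evalℚ q (pt a)) (g a) (1/ N) N ⟩
        evalℚ q (pt a) + (g a - evalℚ q (pt a)) * (1/ N * N)
          ≡⟨ cong (λ u → evalℚ q (pt a) + (g a - evalℚ q (pt a)) * u) (ℚP.*-inverseˡ N) ⟩
        evalℚ q (pt a) + (g a - evalℚ q (pt a)) * 1ℚ
          ≡⟨ solve 2 (λ Q G → Q :+ (G :- Q) :* con 1ℚ := G) refl (evalℚ q (pt a)) (g a) ⟩
        g a                                             ∎
      agrees-on-ys : ∀ {y} → y ∈ ys → evalℚ (q +ₚ c ·ₚ nodalPoly ys) (pt y) ≡ g y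
      agrees-on-ys {y} y∈ys = begin
        evalℚ (q +ₚ c ·ₚ nodalPoly ys) (pt y) ≡⟨ eval-extension (pt y) ⟩
        evalℚ q (pt y) + c * nodal ys (pt y)
          ≡⟨ cong₂ (λ u v → u + c * v) (All.lookup q-agrees y∈ys) (nodal-root y∈ys) ⟩
        g y + c * 0ℚ                          ≡⟨ cong (λ u → g y + u) (ℚP.*-zeroʳ c) ⟩
        g y + 0ℚ                              ≡⟨ ℚP.+-identityʳ (g y) ⟩
        g y                                   ∎

    length-newton : ∀ q c ys → length q ≤ length ys → length (q +ₚ c ·ₚ nodalPoly ys) ≤ suc (length ys)
    length-newton q c ys q≤ = length-+ₚ-≤ q (c ·ₚ nodalPoly ys) (ℕP.m≤n⇒m≤1+n q≤)
      (ℕP.≤-reflexive (trans (length-·ₚ c (nodalPoly ys)) (length-nodalPoly ys)))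

    newton-integral : (∀ a → Integral (pt a)) → ∀ q c ys → All Integral q → Integral c
      → All Integral (q +ₚ c ·ₚ nodalPoly ys)
    newton-integral pt-integral q c ys q-integral c-integral =
      +ₚ-integral {q} q-integral (·ₚ-integral {c} c-integral (nodalPoly-integral pt-integral ys))

    coeff-newton : ∀ q c ys → length q ≤ length ys → coeff (q +ₚ c ·ₚ nodalPoly ys) (length ys) ≡ c
    coeff-newton q c ys q≤ = begin
      coeff (q +ₚ c ·ₚ nodalPoly ys) (length ys)
        ≡⟨ coeff-+ₚ q (c ·ₚ nodalPoly ys) (length ys) ⟩
      coeff q (length ys) + coeff (c ·ₚ nodalPoly ys) (length ys)
        ≡⟨ cong₂ _+_ (length≤⇒coeff≡0 q q≤) (coeff-·ₚ c (nodalPoly ys) (length ys)) ⟩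
      0ℚ + c * coeff (nodalPoly ys) (length ys)  ≡⟨ cong (λ u → 0ℚ + c * u) (nodalPoly-monic ys) ⟩
      0ℚ + c * 1ℚ                                ≡⟨ solve 1 (λ c → con 0ℚ :+ c :* con 1ℚ := c) refl c ⟩
      c                                          ∎
      where open ≡-Reasoning

  module _ {U : ℤ → Set} (f : Σ ℤ U → ℤ) where

    point : Σ ℤ U → ℚ
    point a = ι (proj₁ a)

    point-integral : ∀ a → Integral (point a)
    point-integral a = proj₁ a , refl

    open Nodes point

    Agrees : List ℚ → List (Σ ℤ U) → Set
    Agrees q = All (λ y → evalℚ q (point y) ≡ ι (f y))

    agrees⇒agree : ∀ p q {Y} → Agrees p Y → Agrees q Y
      → All (λ y → evalℚ p (point y) ≡ evalℚ q (point y)) Y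
    agrees⇒agree p q p-agrees q-agrees = All.zipWith (λ (py , qy) → trans py (sym qy)) (p-agrees , q-agrees)

    unique⇒distinct : ∀ {X} → Unique (map proj₁ X) → Distinct X
    unique⇒distinct unique = AllPairs.map (λ m≢n → m≢n ∘ ι-injective) (AllPairsP.map⁻ unique)

    agrees-─⇒agrees-─-─ : ∀ {q X a b} → Distinct X
      → (a∈X : a ∈ X) (b∈X : b ∈ X) (b∈Xa : b ∈ (X ─ a∈X)) → Agrees q (X ─ b∈X) → Agrees q ((X ─ a∈X) ─ b∈Xa)
    agrees-─⇒agrees-─-─ distinct a∈X b∈X b∈Xa q-agrees = All.tabulate λ y∈Y →
      All.lookup q-agrees (∈-─⁺ b∈X (∈-─⁻ a∈X (∈-─⁻ b∈Xa y∈Y))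
        (λ y≡b → All.lookup (distinct-─ (─-AllPairs a∈X distinct) b∈Xa) y∈Y (cong point (sym y≡b))))

    interp-minus-drop : ∀ X q qa {a} → Distinct X → IsInterp f X q
      → (a∈X : a ∈ X) → IsInterp f (X ─ a∈X) qa
      → ∀ x → evalℚ q x - evalℚ qa x ≡ coeff q (length (X ─ a∈X)) * nodal (X ─ a∈X) x
    interp-minus-drop X q qa distinct (q≤ , q-agrees) a∈X (qa≤ , qa-agrees) x = begin
      evalℚ q x - evalℚ qa x
        ≡⟨ agree⇒difference-nodal (X ─ a∈X) q qa (─-AllPairs a∈X distinct)
             (subst (length q ≤_) (length-─ a∈X) q≤) (ℕP.m≤n⇒m≤1+n qa≤)
             (agrees⇒agree q qa (─⁺ a∈X q-agrees) qa-agrees) x ⟩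
      (c - coeff qa (length (X ─ a∈X))) * nodal (X ─ a∈X) x
        ≡⟨ cong (λ u → (c - u) * nodal (X ─ a∈X) x) (length≤⇒coeff≡0 qa qa≤) ⟩
      (c - 0ℚ) * nodal (X ─ a∈X) x
        ≡⟨ cong (_* nodal (X ─ a∈X) x) (ℚP.+-identityʳ c) ⟩
      c * nodal (X ─ a∈X) x ∎
      where
      open ≡-Reasoning
      c = coeff q (length (X ─ a∈X))

    circuit⇒nonintegral-lead : ∀ X → Circuit f X → ∃[ q ] IsInterp f X q × ¬ IsInt (coeff q (length X ∸ 1))
    circuit⇒nonintegral-lead []      (_ , not-integral , _) = ⊥-elim (not-integral ([] , (z≤n , []) , []))
    circuit⇒nonintegral-lead (a ∷ X) (unique , not-integral , drop)
      with drop zero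
    ... | q₀ , (q₀≤ , q₀-agrees) , q₀-integral = q , interp , c-nonintegral
      where
      extension = newton-step (ι ∘ f) a X q₀ (AllPairs.head (unique⇒distinct {a ∷ X} unique)) q₀-agrees
      c = proj₁ extension
      q = q₀ +ₚ c ·ₚ nodalPoly X
      interp : IsInterp f (a ∷ X) q
      interp = length-newton q₀ c X q₀≤ , proj₂ extension
      c-nonintegral : ¬ IsInt (coeff q (length X))
      c-nonintegral c∈ℤ = not-integral (q , interp , All.map Integral⇒IsInt
        (newton-integral point-integral q₀ c X (All.map IsInt⇒Integral q₀-integral)
          (IsInt⇒Integral (subst IsInt (coeff-newton q₀ c X q₀≤) c∈ℤ))))

    lead*difference-integral : ∀ X {q a b} → Distinct X → (∀ i → InterpInZ f (removeAt X i))
      → IsInterp f X q → a ∈ X → b ∈ X → Integral (coeff q (length X ∸ 1) * ι (proj₁ a ℤ.- proj₁ b))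
    lead*difference-integral X {q} {a} {b} distinct drop q-interp@(_ , q-agrees) a∈X b∈X
      with proj₁ a ℤ.≟ proj₁ b
    ... | yes a≡b = + 0 , trans (cong (λ z → coeff q (length X ∸ 1) * ι z) (ℤP.i≡j⇒i-j≡0 a≡b))
                      (ℚP.*-zeroʳ (coeff q (length X ∸ 1)))
    ... | no a≢b with drop (index a∈X) | drop (index b∈X)
    ... | qa , qa-interp@(qa≤ , qa-agrees) , qa-integral | qb , (qb≤ , qb-agrees) , qb-integral =
      subst (λ n → Integral (coeff q (n ∸ 1) * ι (proj₁ a ℤ.- proj₁ b))) (sym (length-─ a∈X))
            (ℤ.- (ea ℤ.- eb) , lead*difference)
      where
      open ≡-Reasoning
      Xa = X ─ a∈X
      b∈Xa : b ∈ Xa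
      b∈Xa = ∈-─⁺ a∈X b∈X (a≢b ∘ cong proj₁ ∘ sym)
      Y = Xa ─ b∈Xa
      c = coeff q (length Xa)
      N = nodal Y (point a)
      coeff-qa = coeff-integral (All.map IsInt⇒Integral qa-integral) (length Y)
      coeff-qb = coeff-integral (All.map IsInt⇒Integral qb-integral) (length Y)
      ea = proj₁ coeff-qa
      eb = proj₁ coeff-qb
      q-qa : evalℚ q (point a) - evalℚ qa (point a) ≡ c * (point a - point b) * N
      q-qa = begin
        evalℚ q (point a) - evalℚ qa (point a)
          ≡⟨ interp-minus-drop X q qa distinct q-interp a∈X qa-interp (point a) ⟩
        c * nodal Xa (point a)                 ≡⟨ cong (c *_) (nodal-─ b∈Xa (point a)) ⟩
        c * ((point a - point b) * N)          ≡⟨ ℚP.*-assoc c (point a - point b) N ⟨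
        c * (point a - point b) * N            ∎
      qa-qb : evalℚ qa (point a) - evalℚ qb (point a) ≡ (ι ea - ι eb) * N
      qa-qb = trans (agree⇒difference-nodal Y qa qb (─-AllPairs b∈Xa (─-AllPairs a∈X distinct))
                      (subst (length qa ≤_) (length-─ b∈Xa) qa≤)
                      (subst (length qb ≤_) (trans (length-─-irrelevant b∈X a∈X) (length-─ b∈Xa)) qb≤)
                      (agrees⇒agree qa qb (─⁺ b∈Xa qa-agrees)
                        (agrees-─⇒agrees-─-─ {qb} distinct a∈X b∈X b∈Xa qb-agrees))
                      (point a))
                    (cong₂ (λ u v → (u - v) * N) (proj₂ coeff-qa) (proj₂ coeff-qb))
      q≡qb : evalℚ q (point a) ≡ evalℚ qb (point a)
      q≡qb = trans (All.lookup q-agrees a∈X) (sym (All.lookup qb-agrees (∈-─⁺ b∈X a∈X (a≢b ∘ cong proj₁))))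
      N≢0 : N ≢ 0ℚ
      N≢0 = nodal-nonzero Y (─⁺ b∈Xa (distinct-─ distinct a∈X))
      lead*difference : c * ι (proj₁ a ℤ.- proj₁ b) ≡ ι (ℤ.- (ea ℤ.- eb))
      lead*difference = begin
        c * ι (proj₁ a ℤ.- proj₁ b)  ≡⟨ cong (c *_) (ι-homo-[-] (proj₁ a) (proj₁ b)) ⟩
        c * (point a - point b)      ≡⟨ cancel-nonzero-factor N≢0 q≡qb q-qa qa-qb ⟩
        - (ι ea - ι eb)              ≡⟨ cong -_ (ι-homo-[-] ea eb) ⟨
        - ι (ea ℤ.- eb)              ≡⟨ ι-homo‿- (ea ℤ.- eb) ⟨
        ι (ℤ.- (ea ℤ.- eb))          ∎

open import Data.Integer using (_-_)
open import Data.Integer.Divisibility using (_∣_)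

-- Having a circuit already makes f non-LIP.
lemma7 : (U : ℤ → Set) (f : Σ ℤ U → ℤ) → ¬ LIP f
         → (X : List (Σ ℤ U)) → Circuit f X
         → ∃ λ q → IsInterp f X q
                   × ¬ IsInt (coeff q (length X ∸ 1))
                   × ((a b : Σ ℤ U) → a ∈ X → b ∈ X
                      → (+ denom (coeff q (length X ∸ 1))) ∣ (proj₁ a - proj₁ b))
lemma7 U f _ X circuit@(unique , _ , drop) with circuit⇒nonintegral-lead f X circuit
... | q , interp , lead-nonintegral = q , interp , lead-nonintegral , λ a b a∈X b∈X →
  Integral[c*m]⇒denom[c]∣m (coeff q (length X ∸ 1)) (proj₁ a - proj₁ b)
    (lead*difference-integral f X {q} (unique⇒distinct f unique) drop interp a∈X b∈X)
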